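{- Let $t\ge 1$ be an integer. Then $\chi_p(P_{2t}\Diamond_2 C_5)\le 4$ if $t=1$, $\chi_p(P_{2t}\Diamond_2 C_5)\le 5$ if $2\le t\le 4$, and $\chi_p(P_{2t}\Diamond_2 C_5)\le 6$ if $t\ge 5$. Moreover, equality holds for $t\in\{1,2,3,4\}$.
   Context: A packing $k$-coloring of a graph $H$ is a map $c:V(H)\to\{1,\ldots,k\}$ such that any two distinct vertices $u,v$ with $c(u)=c(v)=i$ satisfy $d_H(u,v)\ge i+1$. The packing chromatic number $\chi_p(H)$ is the least such $k$. $P_m$ denotes the path $v_1\cdots v_m$ and $C_n$ the cycle on $n$ vertices. Path-aligned product: for positive integers $\ell\mid m$ and a connected vertex-transitive graph $G$ containing $P_\ell$ as a subgraph, $P_m\Diamond_\ell G$ is formed from the path $P_m=v_1\cdots v_m$ and $m/\ell$ pairwise disjoint copies of $G$, where for each $1\le i\le m/\ell$ the consecutive path vertices $v_{(i-1)\ell+1},\ldots,v_{i\ell}$ are identified, in order, with the vertices of a path $P_\ell$ (i.e. $\ell$ consecutive cycle vertices when $G$ is a cycle) in the $i$-th copy of $G$. -}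

module Defs where

open import Data.Nat using (ℕ; zero; suc; _+_; _≤_; _<_)
open import Data.Fin using (Fin; toℕ)
import Data.Fin as Fin
open import Data.Product using (_×_; Σ)
open import Data.Sum using (_⊎_)
open import Relation.Binary.PropositionalEquality using (_≡_; _≢_)
open import Relation.Nullary using (¬_)

record Graph : Set₁ where
  field
    V : Set
    E : V → V → Set

open Graph public

data Walk (H : Graph) : V H → V H → ℕ → Set where
  here : ∀ {u} → Walk H u u 0
  step : ∀ {u w v n} → E H u w → Walk H w v n → Walk H u v (suc n)

-- d_H(u,v) ≥ r  :⇔  there is no walk from u to v of length < r
-- (d_H is the shortest-walk distance; ∞ if u,v are disconnected).
DistGE : (H : Graph) → V H → V H → ℕ → Set
DistGE H u v r = ∀ n → n < r → ¬ Walk H u v n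

record PackingColoring (H : Graph) (k : ℕ) : Set where
  field
    c       : V H → ℕ
    c-pos   : ∀ v → 1 ≤ c v
    c-bound : ∀ v → c v ≤ k
    packing : ∀ u v → u ≢ v → c u ≡ c v → DistGE H u v (suc (c u))

-- χ_p(H) ≤ k  (χ_p is the least k admitting a packing k-coloring; any packing
-- j-coloring with j ≤ k is a packing k-coloring, so this is existence of one).
χp≤ : Graph → ℕ → Set
χp≤ H k = PackingColoring H k

χp≡ : Graph → ℕ → Set
χp≡ H k = PackingColoring H k × (∀ j → j < k → ¬ PackingColoring H j)

SuccMod : (n : ℕ) → ℕ → ℕ → Set
SuccMod n a b = (suc a < n × b ≡ suc a) ⊎ (suc a ≡ n × b ≡ 0)

Cycle : ℕ → Graph
Cycle n = record
  { V = Fin n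
  ; E = λ a b → SuccMod n (toℕ a) (toℕ b) ⊎ SuccMod n (toℕ b) (toℕ a)
  }

-- Path-aligned product P_{q·ℓ} ◇_ℓ G with q copies of G, where the argument
-- l is ℓ-1 (so the path P_ℓ has suc l = ℓ vertices).
-- p : Fin ℓ → V G is the chosen path P_ℓ in G (p j ~ p (j+1)); in copy i
-- (i = 0,…,q-1) the vertex p j is the path vertex v_{iℓ+j+1}.
PathAligned : (q l : ℕ) (G : Graph) → (Fin (suc l) → V G) → Graph
PathAligned q l G p = record
  { V = Fin q × V G
  ; E = λ x y → AdjPA x y ⊎ AdjPA y x
  }
  where
  open import Data.Product using (proj₁; proj₂)
  open import Data.Fin using (zero; fromℕ)
  AdjPA : Fin q × V G → Fin q × V G → Set
  AdjPA x y =
      (proj₁ x ≡ proj₁ y × E G (proj₂ x) (proj₂ y))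
    ⊎ (suc (toℕ (proj₁ x)) ≡ toℕ (proj₁ y) × proj₂ x ≡ p (fromℕ l) × proj₂ y ≡ p zero)

p01 : Fin 2 → Fin 5
p01 Fin.zero = Fin.zero
p01 (Fin.suc _) = Fin.suc Fin.zero

P2t◇C5 : ℕ → Graph
P2t◇C5 t = PathAligned t 1 (Cycle 5) p01

{-# OPTIONS --safe #-}
-- For t ≤ 4 everything is a finite computation: a colouring is checked vertex by vertex (no vertex
-- u may share its colour with another vertex of the ball of radius c(u) around u), and the lower
-- bounds χp ≥ 4 for t = 1 and χp ≥ 5 for t = 2 come from an exhaustive backtracking search; the
-- latter passes to t = 3, 4 because P₄ ◇₂ C₅ is a subgraph of P₂ₜ ◇₂ C₅.
-- For every t, reducing copy indices mod 7 maps P₂ₜ ◇₂ C₅ homomorphically to the ring of 7 copies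
-- of C₅ (the last copy joined back to the first); copy indices change by at most 1 along an edge,
-- so this map identifies no two vertices at distance ≤ 6, and a packing 6-colouring of the ring
-- pulls back.
module Submission where

open import Defs
open import Data.Empty using (⊥; ⊥-elim)
open import Data.Fin using (Fin; toℕ; fromℕ; fromℕ<; inject≤)
import Data.Fin as Fin
open import Data.Fin.Properties
  using (toℕ-fromℕ<; toℕ-injective; fromℕ<-injective; inject≤-injective; toℕ-inject≤)
open import Data.List using (List; []; _∷_; filter; concatMap; applyUpTo; allFin; cartesianProduct)
open import Data.List.Membership.Propositional using (_∈_; find; lose)
open import Data.List.Membership.Propositional.Properties
  using (∈-filter⁺; ∈-filter⁻; ∈-concatMap⁺; ∈-concatMap⁻; ∈-applyUpTo⁺; ∈-allFin;
         ∈-cartesianProduct⁺)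
open import Data.List.Relation.Unary.All as All using (All; []; _∷_; all?)
open import Data.List.Relation.Unary.Any using (here; there)
open import Data.Nat
  using (ℕ; zero; suc; _+_; _∸_; _*_; _≤_; _<_; _≤?_; _<?_; z≤n; s≤s; s≤s⁻¹; NonZero; ∣_-_∣)
import Data.Nat as ℕ
open import Data.Nat.DivMod using (_%_; _/_; m%n<n; m≡m%n+[m/n]*n; %-distribˡ-+; m%n%n≡m%n)
open import Data.Nat.Properties
  using (≤-trans; ≤-<-trans; ≤-reflexive; n≤1+n; n<1+n; m+n∸n≡m; +-mono-≤; *-cancelʳ-<;
         n<1⇒n≡0; *-identityˡ; ∣n-n∣≡0; ∣-∣-comm; ∣-∣-triangle; ∣m-n∣≡0⇒m≡n; m≤n⇒∣m-n∣≡n∸m;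
         ∣m+n-m+o∣≡∣n-o∣; *-distribʳ-∣-∣)
open import Data.Product using (_×_; _,_; proj₁; proj₂; ∃-syntax; map₁)
open import Data.Product.Properties using (≡-dec)
open import Data.Sum as Sum using (_⊎_; inj₁; inj₂)
open import Data.Unit using (tt)
open import Data.Vec using (Vec; []; _∷_; lookup)
open import Relation.Binary.Definitions using (Decidable; DecidableEquality)
open import Relation.Binary.PropositionalEquality
  using (_≡_; _≢_; refl; sym; trans; cong; cong₂; subst; subst₂; module ≡-Reasoning)
open import Relation.Nullary using (Dec; yes; no; ¬_; ¬?)
open import Relation.Nullary.Decidable using (True; toWitness; _×-dec_; _⊎-dec_; _→-dec_)

Homomorphism : (H H′ : Graph) → (V H → V H′) → Set
Homomorphism H H′ f = ∀ {x y} → E H x y → E H′ (f x) (f y)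

map-Walk : ∀ {H H′ f} → Homomorphism H H′ f → ∀ {u v n} → Walk H u v n → Walk H′ (f u) (f v) n
map-Walk hom here       = here
map-Walk hom (step e w) = step (hom e) (map-Walk hom w)

InjectiveWithin : (H : Graph) {B : Set} → ℕ → (V H → B) → Set
InjectiveWithin H r f = ∀ {u v n} → Walk H u v n → n ≤ r → f u ≡ f v → u ≡ v

weaken-packing : ∀ {H j k} → j ≤ k → PackingColoring H j → PackingColoring H k
weaken-packing j≤k pc = record
  { c = c ; c-pos = c-pos ; c-bound = λ v → ≤-trans (c-bound v) j≤k ; packing = packing }
  where open PackingColoring pc

pullback-packing : ∀ {H H′ k f} → Homomorphism H H′ f → InjectiveWithin H k f →
                   PackingColoring H′ k → PackingColoring H k
pullback-packing {f = f} hom inj pc = record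
  { c = λ v → c (f v) ; c-pos = λ v → c-pos (f v) ; c-bound = λ v → c-bound (f v)
  ; packing = λ u v u≢v same n n<1+c w →
      packing (f u) (f v) (λ fu≡fv → u≢v (inj w (≤-trans (s≤s⁻¹ n<1+c) (c-bound (f u))) fu≡fv))
              same n n<1+c (map-Walk hom w) }
  where open PackingColoring pc

record Finite (H : Graph) : Set where
  field
    vertices   : List (V H)
    ∈-vertices : ∀ v → v ∈ vertices
    _≟_        : DecidableEquality (V H)
    adjacent?  : Decidable (E H)

module FiniteGraph {H : Graph} (finite : Finite H) where
  open Finite finite
  open import Data.List.Membership.DecPropositional _≟_ using (_∈?_)

  neighbours : V H → List (V H)
  neighbours u = filter (adjacent? u) vertices

  ball : ℕ → V H → List (V H)
  ball zero    u = u ∷ []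
  ball (suc r) u = u ∷ concatMap (ball r) (neighbours u)

  walk⇒∈ball : ∀ {u v n r} → Walk H u v n → n ≤ r → v ∈ ball r u
  walk⇒∈ball {r = zero}  here       _          = here refl
  walk⇒∈ball {r = suc r} here       _          = here refl
  walk⇒∈ball             (step e w) (s≤s n≤r) =
    there (∈-concatMap⁺ (ball _)
            (lose (∈-filter⁺ (adjacent? _) (∈-vertices _) e) (walk⇒∈ball w n≤r)))

  ∈ball⇒walk : ∀ {u v} r → v ∈ ball r u → ∃[ n ] n ≤ r × Walk H u v n
  ∈ball⇒walk zero    (here refl) = 0 , z≤n , here
  ∈ball⇒walk (suc r) (here refl) = 0 , z≤n , here
  ∈ball⇒walk {u} (suc r) (there v∈)
    with w , w∈neighbours , v∈ball ← find (∈-concatMap⁻ (ball r) {xs = neighbours u} v∈)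
    with n , n≤r , w↝v ← ∈ball⇒walk r v∈ball
    = suc n , s≤s n≤r , step (proj₂ (∈-filter⁻ (adjacent? u) {xs = vertices} w∈neighbours)) w↝v

  Proper : ℕ → (V H → ℕ) → V H → Set
  Proper k c u = 1 ≤ c u × c u ≤ k × All (λ v → v ≡ u ⊎ c v ≢ c u) (ball (c u) u)

  proper? : ∀ k c u → Dec (Proper k c u)
  proper? k c u =
    1 ≤? c u ×-dec c u ≤? k ×-dec all? (λ v → v ≟ u ⊎-dec ¬? (c v ℕ.≟ c u)) (ball (c u) u)

  packingColoring : ∀ k c → True (all? (proper? k c) vertices) → PackingColoring H k
  packingColoring k c all-proper = record
    { c = c ; c-pos = λ v → proj₁ (proper v) ; c-bound = λ v → proj₁ (proj₂ (proper v))
    ; packing = packing }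
    where
    proper : ∀ v → Proper k c v
    proper v = All.lookup (toWitness all-proper) (∈-vertices v)
    packing : ∀ u v → u ≢ v → c u ≡ c v → DistGE H u v (suc (c u))
    packing u v u≢v cu≡cv n n<1+cu w
      with All.lookup (proj₂ (proj₂ (proper u))) (walk⇒∈ball w (s≤s⁻¹ n<1+cu))
    ... | inj₁ v≡u  = u≢v (sym v≡u)
    ... | inj₂ cv≢cu = cv≢cu (sym cu≡cv)

  Compatible : List (V H × ℕ) → V H → ℕ → Set
  Compatible σ v a = All (λ (w , b) → b ≡ a → w ∈ ball a v → w ≡ v) σ

  compatible? : ∀ σ v a → Dec (Compatible σ v a)
  compatible? σ v a = all? (λ (w , b) → b ℕ.≟ a →-dec w ∈? ball a v →-dec w ≟ v) σ

  colours : ℕ → List ℕ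
  colours k = applyUpTo suc k

  -- A backtracking search tree: every extension of the partial colouring σ along vs hits a clash.
  Refuted : ℕ → List (V H) → List (V H × ℕ) → Set
  Refuted k []       σ = ⊥
  Refuted k (v ∷ vs) σ = All (λ a → ¬ Compatible σ v a ⊎ Refuted k vs ((v , a) ∷ σ)) (colours k)

  refuted? : ∀ k vs σ → Dec (Refuted k vs σ)
  refuted? k []       σ = no λ ()
  refuted? k (v ∷ vs) σ =
    all? (λ a → ¬? (compatible? σ v a) ⊎-dec refuted? k vs ((v , a) ∷ σ)) (colours k)

  colour∈colours : ∀ {a k} → 1 ≤ a → a ≤ k → a ∈ colours k
  colour∈colours {suc a} _ a<k = ∈-applyUpTo⁺ suc a<k

  module _ {k} (pc : PackingColoring H k) where
    open PackingColoring pc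

    Agrees : V H × ℕ → Set
    Agrees (w , b) = c w ≡ b

    compatible : ∀ {σ} v → All Agrees σ → Compatible σ v (c v)
    compatible v = All.map separated
      where
      separated : ∀ {(w , b) : V H × ℕ} → c w ≡ b → b ≡ c v → w ∈ ball (c v) v → w ≡ v
      separated {w , b} cw≡b b≡cv w∈ball with w ≟ v
      ... | yes w≡v = w≡v
      ... | no w≢v with n , n≤cv , v↝w ← ∈ball⇒walk (c v) w∈ball =
        ⊥-elim (packing v w (λ v≡w → w≢v (sym v≡w)) (sym (trans cw≡b b≡cv)) n (s≤s n≤cv) v↝w)

    refuted-sound : ∀ vs {σ} → Refuted k vs σ → All Agrees σ → ⊥
    refuted-sound (v ∷ vs) refuted agrees
      with All.lookup refuted (colour∈colours (c-pos v) (c-bound v))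
    ... | inj₁ incompatible = incompatible (compatible v agrees)
    ... | inj₂ refuted′     = refuted-sound vs refuted′ (refl ∷ agrees)

  noPackingColoring : ∀ k → True (refuted? k vertices []) → ∀ j → j < suc k → ¬ PackingColoring H j
  noPackingColoring k refuted j j<1+k pc =
    refuted-sound (weaken-packing (s≤s⁻¹ j<1+k) pc) vertices (toWitness refuted) []

successorMod? : ∀ n a b → Dec (SuccMod n a b)
successorMod? n a b = (suc a <? n ×-dec b ℕ.≟ suc a) ⊎-dec (suc a ℕ.≟ n ×-dec b ℕ.≟ 0)

Cycle-finite : ∀ n → Finite (Cycle n)
Cycle-finite n = record
  { vertices   = allFin n
  ; ∈-vertices = ∈-allFin
  ; _≟_        = Fin._≟_
  ; adjacent?  = λ a b → successorMod? n (toℕ a) (toℕ b) ⊎-dec successorMod? n (toℕ b) (toℕ a)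
  }

Successor : ∀ {q} → Fin q → Fin q → Set
Successor i j = suc (toℕ i) ≡ toℕ j

Successor? : ∀ {q} → Decidable (Successor {q})
Successor? i j = suc (toℕ i) ℕ.≟ toℕ j

CyclicSuccessor : ∀ {q} .{{_ : NonZero q}} → Fin q → Fin q → Set
CyclicSuccessor {q} i j = suc (toℕ i) % q ≡ toℕ j

CyclicSuccessor? : ∀ {q} .{{_ : NonZero q}} → Decidable (CyclicSuccessor {q})
CyclicSuccessor? {q} i j = suc (toℕ i) % q ℕ.≟ toℕ j

module _ {q l : ℕ} (Next : Fin q → Fin q → Set) (G : Graph) (p : Fin (suc l) → V G) where

  AlignedArc : Fin q × V G → Fin q × V G → Set
  AlignedArc (i , x) (j , y) = (i ≡ j × E G x y) ⊎ (Next i j × x ≡ p (fromℕ l) × y ≡ p Fin.zero)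

  -- `PathAligned q l G p` is, by definition, `Aligned Successor G p`.
  Aligned : Graph
  Aligned = record { V = Fin q × V G ; E = λ u v → AlignedArc u v ⊎ AlignedArc v u }

Aligned-finite : ∀ {q l Next G} {p : Fin (suc l) → V G} →
                 Decidable Next → Finite G → Finite (Aligned {q} Next G p)
Aligned-finite {q} {l} {Next} {G} {p} next? finite = record
  { vertices   = cartesianProduct (allFin q) vertices
  ; ∈-vertices = λ (i , x) → ∈-cartesianProduct⁺ (∈-allFin i) (∈-vertices x)
  ; _≟_        = ≡-dec Fin._≟_ _≟_
  ; adjacent?  = λ u v → arc? u v ⊎-dec arc? v u
  }
  where
  open Finite finite
  arc? : ∀ u v → Dec (AlignedArc Next G p u v)
  arc? (i , x) (j , y) =
    (i Fin.≟ j ×-dec adjacent? x y) ⊎-dec (next? i j ×-dec x ≟ p (fromℕ l) ×-dec y ≟ p Fin.zero)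

PathAligned-finite : ∀ {q l G p} → Finite G → Finite (PathAligned q l G p)
PathAligned-finite {p = p} = Aligned-finite {p = p} Successor?

[1+m%n]%n≡[1+m]%n : ∀ m n .{{_ : NonZero n}} → suc (m % n) % n ≡ suc m % n
[1+m%n]%n≡[1+m]%n m n = begin
  (1 + m % n) % n           ≡⟨ %-distribˡ-+ 1 (m % n) n ⟩
  (1 % n + m % n % n) % n   ≡⟨ cong (λ r → (1 % n + r) % n) (m%n%n≡m%n m n) ⟩
  (1 % n + m % n) % n       ≡⟨ %-distribˡ-+ 1 m n ⟨
  (1 + m) % n               ∎
  where open ≡-Reasoning

m%d≡n%d⇒m≡n : ∀ {m n} d .{{_ : NonZero d}} → ∣ m - n ∣ < d → m % d ≡ n % d → m ≡ n
m%d≡n%d⇒m≡n {m} {n} d ∣m-n∣<d m%d≡n%d = begin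
  m                     ≡⟨ m≡m%n+[m/n]*n m d ⟩
  m % d + (m / d) * d   ≡⟨ cong₂ (λ r s → r + s * d) m%d≡n%d same-quotient ⟩
  n % d + (n / d) * d   ≡⟨ m≡m%n+[m/n]*n n d ⟨
  n                     ∎
  where
  open ≡-Reasoning
  ∣m-n∣≡∣m/d-n/d∣*d : ∣ m - n ∣ ≡ ∣ m / d - n / d ∣ * d
  ∣m-n∣≡∣m/d-n/d∣*d = begin
    ∣ m - n ∣
      ≡⟨ cong₂ ∣_-_∣ (m≡m%n+[m/n]*n m d) (m≡m%n+[m/n]*n n d) ⟩
    ∣ m % d + (m / d) * d - n % d + (n / d) * d ∣
      ≡⟨ cong (λ r → ∣ m % d + (m / d) * d - r + (n / d) * d ∣) m%d≡n%d ⟨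
    ∣ m % d + (m / d) * d - m % d + (n / d) * d ∣
      ≡⟨ ∣m+n-m+o∣≡∣n-o∣ (m % d) _ _ ⟩
    ∣ (m / d) * d - (n / d) * d ∣
      ≡⟨ *-distribʳ-∣-∣ d (m / d) (n / d) ⟨
    ∣ m / d - n / d ∣ * d
      ∎
  same-quotient : m / d ≡ n / d
  same-quotient = ∣m-n∣≡0⇒m≡n (n<1⇒n≡0 (*-cancelʳ-< d _ 1 ∣m/d-n/d∣*d<1*d))
    where
    ∣m/d-n/d∣*d<1*d : ∣ m / d - n / d ∣ * d < 1 * d
    ∣m/d-n/d∣*d<1*d = subst₂ _<_ ∣m-n∣≡∣m/d-n/d∣*d (sym (*-identityˡ d)) ∣m-n∣<d

module AlignedMaps {l : ℕ} (G : Graph) (p : Fin (suc l) → V G) where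

  homomorphism : ∀ {q q′} {Next : Fin q → Fin q → Set} {Next′ : Fin q′ → Fin q′ → Set}
                 (φ : Fin q → Fin q′) → (∀ {i j} → Next i j → Next′ (φ i) (φ j)) →
                 Homomorphism (Aligned Next G p) (Aligned Next′ G p) (map₁ φ)
  homomorphism {Next = Next} {Next′} φ next = Sum.map arc arc
    where
    arc : ∀ {u v} → AlignedArc Next G p u v → AlignedArc Next′ G p (map₁ φ u) (map₁ φ v)
    arc (inj₁ (refl , e))          = inj₁ (refl , e)
    arc (inj₂ (i→j , x≡p₁ , y≡p₀)) = inj₂ (next i→j , x≡p₁ , y≡p₀)

  restrict-packing : ∀ {q q′ k} → q ≤ q′ →
                     PackingColoring (PathAligned q′ l G p) k → PackingColoring (PathAligned q l G p) k
  restrict-packing q≤q′ = pullback-packing (homomorphism {Next = Successor} {Successor} ι ι-next)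
    λ _ _ eq → cong₂ _,_ (inject≤-injective q≤q′ q≤q′ _ _ (cong proj₁ eq)) (cong proj₂ eq)
    where
    ι : Fin _ → Fin _
    ι i = inject≤ i q≤q′
    ι-next : ∀ {i j} → Successor i j → Successor (ι i) (ι j)
    ι-next {i} {j} i→j = begin
      suc (toℕ (inject≤ i q≤q′)) ≡⟨ cong suc (toℕ-inject≤ i q≤q′) ⟩
      suc (toℕ i)                ≡⟨ i→j ⟩
      toℕ j                      ≡⟨ toℕ-inject≤ j q≤q′ ⟨
      toℕ (inject≤ j q≤q′)       ∎
      where open ≡-Reasoning

  copy-distance : ∀ {t u v n} → Walk (PathAligned t l G p) u v n →
                  ∣ toℕ (proj₁ u) - toℕ (proj₁ v) ∣ ≤ n
  copy-distance {u = i , _} here = ≤-reflexive (∣n-n∣≡0 (toℕ i))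
  copy-distance {u = u} (step {w = w} e w↝v) =
    ≤-trans (∣-∣-triangle (toℕ (proj₁ u)) (toℕ (proj₁ w)) _)
            (+-mono-≤ (edge-distance e) (copy-distance w↝v))
    where
    arc-distance : ∀ {u v} → AlignedArc Successor G p u v →
                   ∣ toℕ (proj₁ u) - toℕ (proj₁ v) ∣ ≤ 1
    arc-distance {i , _} (inj₁ (refl , _)) = ≤-trans (≤-reflexive (∣n-n∣≡0 (toℕ i))) z≤n
    arc-distance {i , _} {j , _} (inj₂ (i→j , _)) = ≤-reflexive (begin
      ∣ toℕ i - toℕ j ∣       ≡⟨ cong (∣ toℕ i -_∣) i→j ⟨
      ∣ toℕ i - suc (toℕ i) ∣ ≡⟨ m≤n⇒∣m-n∣≡n∸m (n≤1+n (toℕ i)) ⟩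
      suc (toℕ i) ∸ toℕ i     ≡⟨ m+n∸n≡m 1 (toℕ i) ⟩
      1                       ∎)
      where open ≡-Reasoning
    edge-distance : ∀ {u v} → E (PathAligned _ l G p) u v →
                    ∣ toℕ (proj₁ u) - toℕ (proj₁ v) ∣ ≤ 1
    edge-distance (inj₁ arc) = arc-distance arc
    edge-distance {u} {v} (inj₂ arc) = subst (_≤ 1) (∣-∣-comm (toℕ (proj₁ v)) _) (arc-distance arc)

  unroll-packing : ∀ {t k} q .{{_ : NonZero q}} → k < q →
                   PackingColoring (Aligned (CyclicSuccessor {q}) G p) k →
                   PackingColoring (PathAligned t l G p) k
  unroll-packing {t} {k} q k<q =
    pullback-packing (homomorphism {Next = Successor} {CyclicSuccessor} wrap wrap-next) injective
    where
    wrap : Fin t → Fin q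
    wrap i = fromℕ< (m%n<n (toℕ i) q)
    toℕ-wrap : ∀ i → toℕ (wrap i) ≡ toℕ i % q
    toℕ-wrap i = toℕ-fromℕ< (m%n<n (toℕ i) q)
    wrap-next : ∀ {i j} → Successor i j → CyclicSuccessor (wrap i) (wrap j)
    wrap-next {i} {j} i→j = begin
      suc (toℕ (wrap i)) % q ≡⟨ cong (λ m → suc m % q) (toℕ-wrap i) ⟩
      suc (toℕ i % q) % q    ≡⟨ [1+m%n]%n≡[1+m]%n (toℕ i) q ⟩
      suc (toℕ i) % q        ≡⟨ cong (_% q) i→j ⟩
      toℕ j % q              ≡⟨ toℕ-wrap j ⟨
      toℕ (wrap j)           ∎
      where open ≡-Reasoning
    injective : InjectiveWithin (PathAligned t l G p) k (map₁ wrap)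
    injective {i , x} {j , y} w n≤k eq = cong₂ _,_
      (toℕ-injective (m%d≡n%d⇒m≡n q (≤-<-trans (copy-distance w) (≤-<-trans n≤k k<q))
                                            (fromℕ<-injective _ _ _ _ (cong proj₁ eq))))
      (cong proj₂ eq)

open AlignedMaps (Cycle 5) p01 using (restrict-packing; unroll-packing)

P2t◇C5-finite : ∀ t → Finite (P2t◇C5 t)
P2t◇C5-finite t = PathAligned-finite {p = p01} (Cycle-finite 5)

module P2t◇C5 (t : ℕ) = FiniteGraph (P2t◇C5-finite t)

Ring◇C5 : Graph
Ring◇C5 = Aligned (CyclicSuccessor {7}) (Cycle 5) p01

Ring◇C5-finite : Finite Ring◇C5
Ring◇C5-finite = Aligned-finite {p = p01} CyclicSuccessor? (Cycle-finite 5)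

module Ring◇C5 = FiniteGraph Ring◇C5-finite

fromRows : ∀ {q} → Vec (Vec ℕ 5) q → Fin q × Fin 5 → ℕ
fromRows rows (i , x) = lookup (lookup rows i) x

packing₁ : PackingColoring (P2t◇C5 1) 4
packing₁ = P2t◇C5.packingColoring 1 4 (fromRows ((1 ∷ 2 ∷ 1 ∷ 3 ∷ 4 ∷ []) ∷ [])) tt

packing₂ : PackingColoring (P2t◇C5 2) 5
packing₂ = P2t◇C5.packingColoring 2 5 (fromRows
  ((1 ∷ 2 ∷ 1 ∷ 3 ∷ 4 ∷ []) ∷ (1 ∷ 3 ∷ 1 ∷ 2 ∷ 5 ∷ []) ∷ [])) tt

packing₃ : PackingColoring (P2t◇C5 3) 5
packing₃ = P2t◇C5.packingColoring 3 5 (fromRows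
  ((1 ∷ 2 ∷ 1 ∷ 3 ∷ 4 ∷ []) ∷ (1 ∷ 5 ∷ 1 ∷ 2 ∷ 3 ∷ []) ∷
   (1 ∷ 2 ∷ 1 ∷ 3 ∷ 4 ∷ []) ∷ [])) tt

packing₄ : PackingColoring (P2t◇C5 4) 5
packing₄ = P2t◇C5.packingColoring 4 5 (fromRows
  ((1 ∷ 2 ∷ 1 ∷ 3 ∷ 4 ∷ []) ∷ (5 ∷ 1 ∷ 2 ∷ 1 ∷ 3 ∷ []) ∷
   (4 ∷ 1 ∷ 3 ∷ 1 ∷ 2 ∷ []) ∷ (2 ∷ 1 ∷ 3 ∷ 5 ∷ 1 ∷ []) ∷ [])) tt

packing-Ring◇C5 : PackingColoring Ring◇C5 6
packing-Ring◇C5 = Ring◇C5.packingColoring 6 (fromRows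
  ((1 ∷ 2 ∷ 1 ∷ 3 ∷ 4 ∷ []) ∷ (1 ∷ 3 ∷ 1 ∷ 2 ∷ 6 ∷ []) ∷ (1 ∷ 4 ∷ 1 ∷ 2 ∷ 5 ∷ []) ∷
   (1 ∷ 2 ∷ 1 ∷ 6 ∷ 3 ∷ []) ∷ (1 ∷ 3 ∷ 1 ∷ 2 ∷ 5 ∷ []) ∷ (1 ∷ 2 ∷ 1 ∷ 6 ∷ 4 ∷ []) ∷
   (1 ∷ 5 ∷ 1 ∷ 2 ∷ 3 ∷ []) ∷ [])) tt

packing-unrolled : ∀ t → PackingColoring (P2t◇C5 t) 6
packing-unrolled t = unroll-packing 7 (n<1+n 6) packing-Ring◇C5

packing-2≤t≤4 : ∀ t → 2 ≤ t → t ≤ 4 → PackingColoring (P2t◇C5 t) 5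
packing-2≤t≤4 1 (s≤s ()) _
packing-2≤t≤4 2 _ _ = packing₂
packing-2≤t≤4 3 _ _ = packing₃
packing-2≤t≤4 4 _ _ = packing₄
packing-2≤t≤4 (suc (suc (suc (suc (suc _))))) _ (s≤s (s≤s (s≤s (s≤s ()))))

noPacking₁ : ∀ j → j < 4 → ¬ PackingColoring (P2t◇C5 1) j
noPacking₁ = P2t◇C5.noPackingColoring 1 3 tt

noPacking₂ : ∀ j → j < 5 → ¬ PackingColoring (P2t◇C5 2) j
noPacking₂ = P2t◇C5.noPackingColoring 2 4 tt

theorem3 : (t : ℕ) → 1 ≤ t →
    ((t ≡ 1 → χp≤ (P2t◇C5 t) 4)
    × (2 ≤ t → t ≤ 4 → χp≤ (P2t◇C5 t) 5)
    × (5 ≤ t → χp≤ (P2t◇C5 t) 6))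
    × ((t ≡ 1 → χp≡ (P2t◇C5 t) 4)
    × (2 ≤ t → t ≤ 4 → χp≡ (P2t◇C5 t) 5))
theorem3 t _ =
  ( (λ { refl → packing₁ }) , packing-2≤t≤4 t , (λ _ → packing-unrolled t) ) ,
  ( (λ { refl → packing₁ , noPacking₁ }) ,
    (λ 2≤t t≤4 → packing-2≤t≤4 t 2≤t t≤4 ,
                 λ j j<5 pc → noPacking₂ j j<5 (restrict-packing 2≤t pc)) )
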